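{- Let $\alpha \geq 1$ and $0 \leq \beta < \alpha$ be integers, let $C(q)$ be a formal power series with $C(0) \neq 0$, and let $\gamma$ be an arithmetic function with $\gamma(1) \neq 0$; put $\widetilde{\gamma}(n) := \sum_{d|n} \gamma(d)$. Define the lower-triangular matrix $(s^{(-1)}_{n,k})_{n,k \geq 1}$ by \[ s_{n,k}^{(-1)} := \sum_{d|n} \left([q^{d-k}] \frac{1}{C(q)}\right) \gamma(n/d), \] and let $(s_{n,k})_{n,k\ge 1}$ be its inverse matrix. For a sequence $(a_n)_{n \geq 1}$, let $(\bar{a}_n)_{n \geq 1}$ be the unique sequence such that \[ \sum_{n \geq 1} \frac{a_n q^{\alpha n+\beta}}{1-q^{\alpha n+\beta}} = \frac{1}{C(q)} \sum_{n \geq 1} \sum_{k=1}^n s_{n,k}\, \bar{a}_k\, q^n . \] Then for all $n \geq 1$, \[ \bar{a}_n = \sum_{\substack{d|n,\ d > \beta \\ d \equiv \beta \bmod \alpha}} a_{\frac{d-\beta}{\alpha}}\, \widetilde{\gamma}(n/d). \]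
   Context: $[q^m] F(q)$ denotes the coefficient of $q^m$ in the power series $F(q)$, taken to be $0$ for $m<0$. An arithmetic function is a function $\mathbb{Z}_{\geq 1} \to \mathbb{C}$. All identities are of formal power series in $q$. -}

module Defs where

open import Level using (Level; _⊔_)
open import Algebra.Bundles using (CommutativeRing)
open import Data.Nat as ℕ using (ℕ; zero; suc; _∸_; _≤?_; _<?_; NonZero)
open import Data.Nat.Divisibility using (_∣?_)
open import Data.Nat.DivMod using (_/_)
open import Data.Product using (Σ; _×_)
open import Relation.Nullary.Decidable using (Dec; yes; no)

-- Everything is stated over an arbitrary commutative ring R (the paper works over ℂ).
module WithRing {c ℓ : Level} (R : CommutativeRing c ℓ) where
  open CommutativeRing R public using (Carrier; _≈_)
  open CommutativeRing R using (_+_; _*_; 0#; 1#)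

  Series : Set c
  Series = ℕ → Carrier

  -- arithmetic functions / sequences indexed from 1 (value at 0 is ignored)
  ArithFun : Set c
  ArithFun = ℕ → Carrier

  -- infinite matrices indexed by n,k ≥ 1 (index 0 ignored)
  Matrix : Set c
  Matrix = ℕ → ℕ → Carrier

  Σ₁ : ℕ → (ℕ → Carrier) → Carrier
  Σ₁ zero f = 0#
  Σ₁ (suc n) f = Σ₁ n f + f (suc n)

  Σ₀ : ℕ → (ℕ → Carrier) → Carrier
  Σ₀ zero f = f zero
  Σ₀ (suc n) f = Σ₀ n f + f (suc n)

  divSum : ℕ → (ℕ → ℕ → Carrier) → Carrier
  divSum n f = Σ₁ n term
    where
    term : ℕ → Carrier
    term zero = 0#
    term (suc i) with suc i ∣? n
    ... | yes _ = f (suc i) (n / suc i)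
    ... | no _ = 0#

  _⋆_ : Series → Series → Series
  (f ⋆ g) m = Σ₀ m (λ i → f i * g (m ∸ i))

  one : Series
  one zero = 1#
  one (suc _) = 0#

  -- [q^m] F, with the convention [q^m] F = 0 for m < 0; here m = d - k
  coeffShift : Series → ℕ → ℕ → Carrier
  coeffShift F d k with k ≤? d
  ... | yes _ = F (d ∸ k)
  ... | no _ = 0#

  δ : ℕ → ℕ → Carrier
  δ n k with n ℕ.≟ k
  ... | yes _ = 1#
  ... | no _ = 0#

  IsUnit : Carrier → Set (c ⊔ ℓ)
  IsUnit x = Σ Carrier (λ u → x * u ≈ 1#)

  γ̃ : ArithFun → ArithFun
  γ̃ γ n = divSum n (λ d _ → γ d)

  -- s^{(-1)}_{n,k} = Σ_{d ∣ n} ([q^{d-k}] 1/C) γ(n/d), where Cinv = 1/C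
  sInv : Series → ArithFun → Matrix
  sInv Cinv γ n k = divSum n (λ d e → coeffShift Cinv d k * γ e)

  LowerTriangular : Matrix → Set ℓ
  LowerTriangular M = ∀ n k → 1 ℕ.≤ n → n ℕ.< k → M n k ≈ 0#

  -- (M N)_{n,k} for lower-triangular M, N : sum over j = 1..n
  IsInverseLT : Matrix → Matrix → Set ℓ
  IsInverseLT M N =
    (∀ n k → 1 ℕ.≤ n → 1 ℕ.≤ k → Σ₁ n (λ j → M n j * N j k) ≈ δ n k) ×
    (∀ n k → 1 ℕ.≤ n → 1 ℕ.≤ k → Σ₁ n (λ j → N n j * M j k) ≈ δ n k)

  -- [q^m] Σ_{n≥1} a_n q^{αn+β}/(1-q^{αn+β}) = Σ_{n ≥ 1, (αn+β) ∣ m} a_n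
  -- (for m ≥ 1 only n ≤ m can contribute; for m = 0 the coefficient is 0)
  lambertCoeff : ℕ → ℕ → ArithFun → Series
  lambertCoeff α β a m = Σ₁ m term
    where
    term : ℕ → Carrier
    term n with (α ℕ.* n ℕ.+ β) ∣? m
    ... | yes _ = a n
    ... | no _ = 0#

  sTransform : Matrix → ArithFun → Series
  sTransform s ā zero = 0#
  sTransform s ā (suc n) = Σ₁ (suc n) (λ k → s (suc n) k * ā k)

  rhsSum : (α β : ℕ) → .{{NonZero α}} → ArithFun → ArithFun → ℕ → Carrier
  rhsSum α β a γ n = divSum n f
    where
    f : ℕ → ℕ → Carrier
    f d e with β <? d | α ∣? (d ∸ β)
    ... | yes _ | yes _ = a ((d ∸ β) / α) * γ̃ γ e
    ... | _ | _ = 0#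

{-# OPTIONS --safe #-}
-- Write T for the series Σ_n Σ_k s_{n,k} ā_k q^n. Since s is a left inverse of s⁽⁻¹⁾, ā_n = Σ_j s⁽⁻¹⁾_{n,j} [q^j] T,
-- and by the shape of s⁽⁻¹⁾ this is the Dirichlet convolution of the coefficients of T/C with γ. By hypothesis
-- T/C is the Lambert series, whose coefficients are c ⊛ 𝟙 with c_e = a_{(e-β)/α} on the progression e ≡ β mod α.
-- Hence ā = (c ⊛ 𝟙) ⊛ γ = c ⊛ (γ ⊛ 𝟙) = c ⊛ γ̃ by associativity and commutativity of Dirichlet convolution,
-- both of which follow by rewriting a divisor sum as a sum over pairs (d, e) with d e = n.
module Submission where

open import Defs
open import Level using (Level)
open import Algebra.Bundles using (CommutativeRing)
open import Data.Nat using (ℕ; _≤_; _<_; NonZero)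
open import Data.Nat as ℕ using (zero; suc; _/_; _∸_; z≤n; s≤s; _≟_; _≤?_; _<?_; _≤′_; ≤′-refl; ≤′-step; >-nonZero)
import Data.Nat.Properties as ℕ
open import Data.Nat.Divisibility using (_∣?_; divides; ∣⇒≤)
open import Data.Nat.DivMod using (m*[n/m]≡n; m*n/n≡m; m/n≤m; m≥n⇒m/n>0)
open import Data.Empty using (⊥-elim)
open import Data.Product using (proj₁)
open import Function using (_∘_)
open import Relation.Nullary using (¬_; Dec; yes; no)
open import Relation.Binary.PropositionalEquality as P using (_≡_; _≢_)
import Algebra.Properties.CommutativeSemigroup as CommutativeSemigroupProperties

open CommutativeSemigroupProperties ℕ.*-commutativeSemigroup using () renaming (xy∙z≈yz∙x to ℕ-xy*z≡yz*x)

factor≤ : ∀ {d e n} → d ℕ.* e ≡ n → 1 ≤ e → d ≤ n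
factor≤ {d} {e} de≡n 1≤e = P.subst (d ≤_) de≡n (ℕ.m≤m*n d e ⦃ >-nonZero 1≤e ⦄)

module Properties {c ℓ} (R : CommutativeRing c ℓ) where
  open WithRing R
  open CommutativeRing R hiding (Carrier; _≈_; zero)
  open CommutativeSemigroupProperties *-commutativeSemigroup using (xy∙z≈xz∙y; xy∙z≈yz∙x)
  open import Relation.Binary.Reasoning.Setoid setoid

  private variable
    p : Level
    A : Set p

  when : Dec A → Carrier → Carrier
  when (yes _) x = x
  when (no _)  _ = 0#

  when-yes : (D : Dec A) {x : Carrier} → A → when D x ≈ x
  when-yes (yes _) _ = refl
  when-yes (no ¬a) a = ⊥-elim (¬a a)

  when-no : (D : Dec A) {x : Carrier} → ¬ A → when D x ≈ 0#
  when-no (yes a) ¬a = ⊥-elim (¬a a)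
  when-no (no _)  _  = refl

  when-cong : (D : Dec A) {x y : Carrier} → (A → x ≈ y) → when D x ≈ when D y
  when-cong (yes a) x≈y = x≈y a
  when-cong (no _)  _   = refl

  when-zero : (D : Dec A) → when D 0# ≈ 0#
  when-zero (yes _) = refl
  when-zero (no _)  = refl

  when-*ʳ : (D : Dec A) (x y : Carrier) → when D x * y ≈ when D (x * y)
  when-*ʳ (yes _) x y = refl
  when-*ʳ (no _)  x y = zeroˡ y

  when-≟-resp : ∀ {i j} n (x : Carrier) → i ≡ j → when (i ≟ n) x ≈ when (j ≟ n) x
  when-≟-resp n x P.refl = refl

  when-≟-swap : {B : ℕ → Set p} (D : ∀ i → Dec (B i)) (q i : ℕ) (x : Carrier) →
                when (D i) (when (q ≟ i) x) ≈ when (q ≟ i) (when (D q) x)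
  when-≟-swap D q i x with q ≟ i
  ... | yes P.refl = refl
  ... | no _       = when-zero (D i)

  Σ₁-cong-on : ∀ n {f g : ℕ → Carrier} → (∀ i → 1 ≤ i → i ≤ n → f i ≈ g i) → Σ₁ n f ≈ Σ₁ n g
  Σ₁-cong-on zero    _     = refl
  Σ₁-cong-on (suc n) f≈g = +-cong (Σ₁-cong-on n (λ i 1≤i i≤n → f≈g i 1≤i (ℕ.m≤n⇒m≤1+n i≤n)))
                                  (f≈g (suc n) (s≤s z≤n) ℕ.≤-refl)

  Σ₁-cong : ∀ n {f g : ℕ → Carrier} → (∀ i → f i ≈ g i) → Σ₁ n f ≈ Σ₁ n g
  Σ₁-cong n f≈g = Σ₁-cong-on n (λ i _ _ → f≈g i)

  Σ₁-zero : ∀ n {f : ℕ → Carrier} → (∀ i → 1 ≤ i → i ≤ n → f i ≈ 0#) → Σ₁ n f ≈ 0#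
  Σ₁-zero zero    _   = refl
  Σ₁-zero (suc n) f≈0 = trans (+-cong (Σ₁-zero n (λ i 1≤i i≤n → f≈0 i 1≤i (ℕ.m≤n⇒m≤1+n i≤n)))
                                      (f≈0 (suc n) (s≤s z≤n) ℕ.≤-refl))
                              (+-identityˡ 0#)

  Σ₁-+ : ∀ n (f g : ℕ → Carrier) → Σ₁ n (λ i → f i + g i) ≈ Σ₁ n f + Σ₁ n g
  Σ₁-+ zero    f g = sym (+-identityˡ 0#)
  Σ₁-+ (suc n) f g = trans (+-congʳ (Σ₁-+ n f g)) (interchange _ _ _ _)
    where open CommutativeSemigroupProperties +-commutativeSemigroup using (interchange)

  Σ₁-*ˡ : ∀ n x (f : ℕ → Carrier) → x * Σ₁ n f ≈ Σ₁ n (λ i → x * f i)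
  Σ₁-*ˡ zero    x f = zeroʳ x
  Σ₁-*ˡ (suc n) x f = trans (distribˡ x _ _) (+-congʳ (Σ₁-*ˡ n x f))

  Σ₁-*ʳ : ∀ n x (f : ℕ → Carrier) → Σ₁ n f * x ≈ Σ₁ n (λ i → f i * x)
  Σ₁-*ʳ zero    x f = zeroˡ x
  Σ₁-*ʳ (suc n) x f = trans (distribʳ x _ _) (+-congʳ (Σ₁-*ʳ n x f))

  when-Σ₁ : (D : Dec A) (n : ℕ) (f : ℕ → Carrier) → when D (Σ₁ n f) ≈ Σ₁ n (λ i → when D (f i))
  when-Σ₁ (yes _) n f = refl
  when-Σ₁ (no _)  n f = sym (Σ₁-zero n (λ _ _ _ → refl))

  Σ₁-swap : ∀ m n (f : ℕ → ℕ → Carrier) →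
            Σ₁ m (λ i → Σ₁ n (λ j → f i j)) ≈ Σ₁ n (λ j → Σ₁ m (λ i → f i j))
  Σ₁-swap zero    n f = sym (Σ₁-zero n (λ _ _ _ → refl))
  Σ₁-swap (suc m) n f = trans (+-congʳ (Σ₁-swap m n f)) (sym (Σ₁-+ n _ _))

  Σ₁-sink : ∀ l m n (f : ℕ → ℕ → ℕ → Carrier) →
            Σ₁ l (λ i → Σ₁ m (λ j → Σ₁ n (λ k → f i j k))) ≈ Σ₁ m (λ j → Σ₁ n (λ k → Σ₁ l (λ i → f i j k)))
  Σ₁-sink l m n f = trans (Σ₁-swap l m _) (Σ₁-cong m (λ j → Σ₁-swap l n _))

  Σ₁-extend : ∀ {m n} {f : ℕ → Carrier} → m ≤ n → (∀ i → m < i → i ≤ n → f i ≈ 0#) → Σ₁ m f ≈ Σ₁ n f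
  Σ₁-extend m≤n = extend (ℕ.≤⇒≤′ m≤n)
    where
    extend : ∀ {m n} {f : ℕ → Carrier} → m ≤′ n → (∀ i → m < i → i ≤ n → f i ≈ 0#) → Σ₁ m f ≈ Σ₁ n f
    extend ≤′-refl              _   = refl
    extend (≤′-step {n} m≤′n) f≈0 = trans (sym (+-identityʳ _))
      (+-cong (extend m≤′n (λ i m<i i≤n → f≈0 i m<i (ℕ.m≤n⇒m≤1+n i≤n)))
              (sym (f≈0 (suc n) (s≤s (ℕ.≤′⇒≤ m≤′n)) ℕ.≤-refl)))

  Σ₁-single : ∀ n k {f : ℕ → Carrier} → 1 ≤ k → k ≤ n →
              (∀ i → 1 ≤ i → i ≤ n → i ≢ k → f i ≈ 0#) → Σ₁ n f ≈ f k
  Σ₁-single zero    _ () z≤n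
  Σ₁-single (suc n) k 1≤k k≤1+n off with k ≟ suc n
  ... | yes P.refl = trans (+-congʳ (Σ₁-zero n (λ i 1≤i i≤n → off i 1≤i (ℕ.m≤n⇒m≤1+n i≤n) (ℕ.<⇒≢ (s≤s i≤n)))))
                           (+-identityˡ _)
  ... | no k≢1+n   = trans (+-cong (Σ₁-single n k 1≤k (ℕ.≤-pred (ℕ.≤∧≢⇒< k≤1+n k≢1+n))
                                                (λ i 1≤i i≤n → off i 1≤i (ℕ.m≤n⇒m≤1+n i≤n)))
                                   (off (suc n) (s≤s z≤n) ℕ.≤-refl (k≢1+n ∘ P.sym)))
                           (+-identityʳ _)

  Σ₁-δ-when : ∀ N q (D : Dec A) y → 1 ≤ q → (A → q ≤ N) →
              Σ₁ N (λ i → when (q ≟ i) (when D y)) ≈ when D y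
  Σ₁-δ-when N q (yes a) y 1≤q q≤N = trans (Σ₁-single N q 1≤q (q≤N a) off) (when-yes (q ≟ q) P.refl)
    where
    off : ∀ i → 1 ≤ i → i ≤ N → i ≢ q → when (q ≟ i) y ≈ 0#
    off i _ _ i≢q = when-no (q ≟ i) (i≢q ∘ P.sym)
  Σ₁-δ-when N q (no _)  y _   _   = Σ₁-zero N (λ i _ _ → when-zero (q ≟ i))

  Σ₀-suc : ∀ n (h : ℕ → Carrier) → Σ₀ (suc n) h ≈ h 0 + Σ₀ n (h ∘ suc)
  Σ₀-suc zero    h = refl
  Σ₀-suc (suc n) h = trans (+-congʳ (Σ₀-suc n h)) (+-assoc _ _ _)

  Σ₀-reverse : ∀ n (h : ℕ → Carrier) → Σ₀ n h ≈ Σ₀ n (λ i → h (n ∸ i))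
  Σ₀-reverse zero    h = refl
  Σ₀-reverse (suc n) h = trans (+-comm _ _) (trans (+-congˡ (Σ₀-reverse n h)) (sym (Σ₀-suc n (λ i → h (suc n ∸ i)))))

  Σ₀≈Σ₁ : ∀ n (h : ℕ → Carrier) → Σ₀ n h ≈ h 0 + Σ₁ n h
  Σ₀≈Σ₁ zero    h = sym (+-identityʳ _)
  Σ₀≈Σ₁ (suc n) h = trans (+-congʳ (Σ₀≈Σ₁ n h)) (+-assoc _ _ _)

  Σ₀-cong-on : ∀ n {f g : ℕ → Carrier} → (∀ i → i ≤ n → f i ≈ g i) → Σ₀ n f ≈ Σ₀ n g
  Σ₀-cong-on zero    f≈g = f≈g 0 z≤n
  Σ₀-cong-on (suc n) f≈g = +-cong (Σ₀-cong-on n (λ i i≤n → f≈g i (ℕ.m≤n⇒m≤1+n i≤n))) (f≈g (suc n) ℕ.≤-refl)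

  coeffShift-> : ∀ F {d j} → d < j → coeffShift F d j ≈ 0#
  coeffShift-> F {d} {j} d<j with j ≤? d
  ... | yes j≤d = ⊥-elim (ℕ.<⇒≱ d<j j≤d)
  ... | no  _   = refl

  coeffShift-≤ : ∀ F {d j} → j ≤ d → coeffShift F d j ≈ F (d ∸ j)
  coeffShift-≤ F {d} {j} j≤d with j ≤? d
  ... | yes _   = refl
  ... | no  j≰d = ⊥-elim (j≰d j≤d)

  Σ₁-coeffShift : ∀ (F T : Series) → T 0 ≈ 0# → ∀ {n d} → d ≤ n →
                  Σ₁ n (λ j → coeffShift F d j * T j) ≈ (F ⋆ T) d
  Σ₁-coeffShift F T T0≈0 {n} {d} d≤n = begin
    Σ₁ n (λ j → coeffShift F d j * T j)
      ≈⟨ Σ₁-extend d≤n (λ j d<j _ → trans (*-congʳ (coeffShift-> F d<j)) (zeroˡ _)) ⟨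
    Σ₁ d (λ j → coeffShift F d j * T j)
      ≈⟨ Σ₁-cong-on d (λ j _ j≤d → *-congʳ (coeffShift-≤ F j≤d)) ⟩
    Σ₁ d (λ j → F (d ∸ j) * T j)
      ≈⟨ trans (sym (+-identityˡ _)) (+-congʳ (sym (trans (*-congˡ T0≈0) (zeroʳ _)))) ⟩
    F (d ∸ 0) * T 0 + Σ₁ d (λ j → F (d ∸ j) * T j)
      ≈⟨ Σ₀≈Σ₁ d _ ⟨
    Σ₀ d (λ j → F (d ∸ j) * T j)
      ≈⟨ Σ₀-reverse d _ ⟩
    Σ₀ d (λ i → F (d ∸ (d ∸ i)) * T (d ∸ i))
      ≈⟨ Σ₀-cong-on d (λ i i≤d → *-congʳ (reflexive (P.cong F (ℕ.m∸[m∸n]≡n i≤d)))) ⟩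
    (F ⋆ T) d ∎

  δ-refl : ∀ n → δ n n ≈ 1#
  δ-refl n with n ≟ n
  ... | yes _   = refl
  ... | no  n≢n = ⊥-elim (n≢n P.refl)

  δ-≢ : ∀ {n k} → n ≢ k → δ n k ≈ 0#
  δ-≢ {n} {k} n≢k with n ≟ k
  ... | yes n≡k = ⊥-elim (n≢k n≡k)
  ... | no  _   = refl

  sTransform-leftInverse : ∀ (M s : Matrix) (ā : ArithFun) → LowerTriangular s →
    (∀ n k → 1 ≤ n → 1 ≤ k → Σ₁ n (λ j → M n j * s j k) ≈ δ n k) →
    ∀ n → 1 ≤ n → Σ₁ n (λ j → M n j * sTransform s ā j) ≈ ā n
  sTransform-leftInverse M s ā s-lower Ms≈I n 1≤n = begin
    Σ₁ n (λ j → M n j * sTransform s ā j)          ≈⟨ Σ₁-cong-on n expand ⟩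
    Σ₁ n (λ j → Σ₁ n (λ k → M n j * (s j k * ā k))) ≈⟨ Σ₁-swap n n _ ⟩
    Σ₁ n (λ k → Σ₁ n (λ j → M n j * (s j k * ā k))) ≈⟨ Σ₁-cong n (λ k → trans (Σ₁-cong n (λ j → sym (*-assoc _ _ _)))
                                                                             (sym (Σ₁-*ʳ n (ā k) _))) ⟩
    Σ₁ n (λ k → Σ₁ n (λ j → M n j * s j k) * ā k)  ≈⟨ Σ₁-cong-on n (λ k 1≤k _ → *-congʳ (Ms≈I n k 1≤n 1≤k)) ⟩
    Σ₁ n (λ k → δ n k * ā k)                        ≈⟨ Σ₁-single n n 1≤n ℕ.≤-refl
                                                         (λ k _ _ k≢n → trans (*-congʳ (δ-≢ (k≢n ∘ P.sym))) (zeroˡ _)) ⟩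
    δ n n * ā n                                     ≈⟨ trans (*-congʳ (δ-refl n)) (*-identityˡ _) ⟩
    ā n ∎
    where
    expand : ∀ j → 1 ≤ j → j ≤ n → M n j * sTransform s ā j ≈ Σ₁ n (λ k → M n j * (s j k * ā k))
    expand (suc j) _ j<n = trans (*-congˡ (Σ₁-extend j<n (λ k j<k _ → trans (*-congʳ (s-lower (suc j) k (s≤s z≤n) j<k)) (zeroˡ _))))
                                 (Σ₁-*ˡ n _ _)

  -- The summands of divSum, lambertCoeff and rhsSum are local functions defined by with;
  -- argumentOf h {s} refl names such a summand t by unifying s with its unfolding h t.
  argumentOf : {B : Set c} (h : B → Carrier) {s : Carrier} {t : B} → s ≡ h t → B
  argumentOf _ {t = t} _ = t

  divSum-divisors : ∀ n (f : ℕ → Carrier) → divSum n (λ d _ → f d) ≈ Σ₁ n (λ d → when (d ∣? n) (f d))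
  divSum-divisors n f = Σ₁-cong-on n summand
    where
    summand : ∀ d → 1 ≤ d → d ≤ n → argumentOf (Σ₁ n) {divSum n (λ d _ → f d)} P.refl d ≈ when (d ∣? n) (f d)
    summand (suc d) _ _ with suc d ∣? n
    ... | yes _ = refl
    ... | no  _ = refl

  Σ₁-cofactor : ∀ N n k .{{_ : NonZero k}} (G : ℕ → Carrier) → 1 ≤ n → n ≤ N →
                Σ₁ N (λ v → when (k ℕ.* v ≟ n) (G v)) ≈ when (k ∣? n) (G (n / k))
  Σ₁-cofactor N n k G 1≤n n≤N with k ∣? n
  ... | yes k∣n = trans (Σ₁-single N (n / k) 1≤n/k (ℕ.≤-trans (m/n≤m n k) n≤N) off) (when-yes (k ℕ.* (n / k) ≟ n) (m*[n/m]≡n k∣n))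
    where
    1≤n/k : 1 ≤ n / k
    1≤n/k = m≥n⇒m/n>0 (∣⇒≤ ⦃ >-nonZero 1≤n ⦄ k∣n)
    off : ∀ v → 1 ≤ v → v ≤ N → v ≢ n / k → when (k ℕ.* v ≟ n) (G v) ≈ 0#
    off v _ _ v≢n/k = when-no (k ℕ.* v ≟ n)
      (λ kv≡n → v≢n/k (P.trans (P.sym (m*n/n≡m v k)) (P.cong (_/ k) (P.trans (ℕ.*-comm v k) kv≡n))))
  ... | no  k∤n = Σ₁-zero N (λ v _ _ → when-no (k ℕ.* v ≟ n) (λ kv≡n → k∤n (divides v (P.trans (P.sym kv≡n) (ℕ.*-comm k v)))))

  pairSum : ℕ → ℕ → (ℕ → ℕ → Carrier) → Carrier
  pairSum N n F = Σ₁ N (λ d → Σ₁ N (λ e → when (d ℕ.* e ≟ n) (F d e)))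

  divSum≈pairSum : ∀ N n F → 1 ≤ n → n ≤ N → divSum n F ≈ pairSum N n F
  divSum≈pairSum N n F 1≤n n≤N = begin
    divSum n F                                                  ≈⟨ Σ₁-cong-on n summand ⟩
    Σ₁ n (λ d → Σ₁ N (λ e → when (d ℕ.* e ≟ n) (F d e)))        ≈⟨ Σ₁-extend n≤N beyond ⟩
    pairSum N n F ∎
    where
    summand : ∀ d → 1 ≤ d → d ≤ n →
              argumentOf (Σ₁ n) {divSum n F} P.refl d ≈ Σ₁ N (λ e → when (d ℕ.* e ≟ n) (F d e))
    summand (suc d) _ _ with suc d ∣? n | Σ₁-cofactor N n (suc d) (F (suc d)) 1≤n n≤N
    ... | yes _ | sum≈F = sym sum≈F
    ... | no  _ | sum≈0 = sym sum≈0
    beyond : ∀ d → n < d → d ≤ N → Σ₁ N (λ e → when (d ℕ.* e ≟ n) (F d e)) ≈ 0#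
    beyond d n<d _ = Σ₁-zero N (λ e 1≤e _ → when-no (d ℕ.* e ≟ n) (λ de≡n → ℕ.<⇒≱ n<d (factor≤ de≡n 1≤e)))

  pairSum-*ʳ : ∀ N n F y → pairSum N n F * y ≈ pairSum N n (λ d e → F d e * y)
  pairSum-*ʳ N n F y = trans (Σ₁-*ʳ N y _) (Σ₁-cong N (λ d → trans (Σ₁-*ʳ N y _)
                         (Σ₁-cong N (λ e → when-*ʳ (d ℕ.* e ≟ n) _ y))))

  divSum-cong : ∀ n {F G : ℕ → ℕ → Carrier} → (∀ d e → 1 ≤ d → 1 ≤ e → d ℕ.* e ≡ n → F d e ≈ G d e) →
                divSum n F ≈ divSum n G
  divSum-cong zero      _   = refl
  divSum-cong n@(suc _) F≈G = begin
    divSum n _    ≈⟨ divSum≈pairSum n n _ (s≤s z≤n) ℕ.≤-refl ⟩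
    pairSum n n _ ≈⟨ Σ₁-cong-on n (λ d 1≤d _ → Σ₁-cong-on n (λ e 1≤e _ →
                       when-cong (d ℕ.* e ≟ n) (F≈G d e 1≤d 1≤e))) ⟩
    pairSum n n _ ≈⟨ divSum≈pairSum n n _ (s≤s z≤n) ℕ.≤-refl ⟨
    divSum n _    ∎

  divSum-*ʳ : ∀ n F y → divSum n F * y ≈ divSum n (λ d e → F d e * y)
  divSum-*ʳ zero      F y = zeroˡ y
  divSum-*ʳ n@(suc _) F y = begin
    divSum n F * y                       ≈⟨ *-congʳ (divSum≈pairSum n n F (s≤s z≤n) ℕ.≤-refl) ⟩
    pairSum n n F * y                    ≈⟨ pairSum-*ʳ n n F y ⟩
    pairSum n n (λ d e → F d e * y)      ≈⟨ divSum≈pairSum n n _ (s≤s z≤n) ℕ.≤-refl ⟨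
    divSum n (λ d e → F d e * y) ∎

  Σ₁-divSum : ∀ m n (F : ℕ → ℕ → ℕ → Carrier) →
              Σ₁ m (λ j → divSum n (F j)) ≈ divSum n (λ d e → Σ₁ m (λ j → F j d e))
  Σ₁-divSum m zero      F = Σ₁-zero m (λ _ _ _ → refl)
  Σ₁-divSum m n@(suc _) F = begin
    Σ₁ m (λ j → divSum n (F j))
      ≈⟨ Σ₁-cong m (λ j → divSum≈pairSum n n (F j) (s≤s z≤n) ℕ.≤-refl) ⟩
    Σ₁ m (λ j → pairSum n n (F j))
      ≈⟨ Σ₁-sink m n n _ ⟩
    Σ₁ n (λ d → Σ₁ n (λ e → Σ₁ m (λ j → when (d ℕ.* e ≟ n) (F j d e))))
      ≈⟨ Σ₁-cong n (λ d → Σ₁-cong n (λ e → when-Σ₁ (d ℕ.* e ≟ n) m _)) ⟨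
    pairSum n n (λ d e → Σ₁ m (λ j → F j d e))
      ≈⟨ divSum≈pairSum n n _ (s≤s z≤n) ℕ.≤-refl ⟨
    divSum n (λ d e → Σ₁ m (λ j → F j d e)) ∎

  Σ₁-pairSum : ∀ n w (F : ℕ → ℕ → Carrier) → 1 ≤ w →
    Σ₁ n (λ x → when (x ℕ.* w ≟ n) (pairSum n x F)) ≈ Σ₁ n (λ u → Σ₁ n (λ v → when (u ℕ.* v ℕ.* w ≟ n) (F u v)))
  Σ₁-pairSum n w F 1≤w = begin
    Σ₁ n (λ x → when (x ℕ.* w ≟ n) (pairSum n x F))
      ≈⟨ Σ₁-cong n (λ x → trans (when-Σ₁ (x ℕ.* w ≟ n) n _) (Σ₁-cong n (λ u → when-Σ₁ (x ℕ.* w ≟ n) n _))) ⟩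
    Σ₁ n (λ x → Σ₁ n (λ u → Σ₁ n (λ v → when (x ℕ.* w ≟ n) (when (u ℕ.* v ≟ x) (F u v)))))
      ≈⟨ Σ₁-sink n n n _ ⟩
    Σ₁ n (λ u → Σ₁ n (λ v → Σ₁ n (λ x → when (x ℕ.* w ≟ n) (when (u ℕ.* v ≟ x) (F u v)))))
      ≈⟨ Σ₁-cong-on n (λ u 1≤u _ → Σ₁-cong-on n (λ v 1≤v _ → collapse u v 1≤u 1≤v)) ⟩
    Σ₁ n (λ u → Σ₁ n (λ v → when (u ℕ.* v ℕ.* w ≟ n) (F u v))) ∎
    where
    collapse : ∀ u v → 1 ≤ u → 1 ≤ v →
      Σ₁ n (λ x → when (x ℕ.* w ≟ n) (when (u ℕ.* v ≟ x) (F u v))) ≈ when (u ℕ.* v ℕ.* w ≟ n) (F u v)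
    collapse u v 1≤u 1≤v = trans (Σ₁-cong n (λ x → when-≟-swap (λ x → x ℕ.* w ≟ n) (u ℕ.* v) x (F u v)))
      (Σ₁-δ-when n (u ℕ.* v) (u ℕ.* v ℕ.* w ≟ n) (F u v) (ℕ.*-mono-≤ 1≤u 1≤v) (λ uvw≡n → factor≤ uvw≡n 1≤w))

  _⊛_ : ArithFun → ArithFun → ArithFun
  (f ⊛ g) n = divSum n (λ d e → f d * g e)

  𝟙 : ArithFun
  𝟙 _ = 1#

  ⊛-congˡ : ∀ {f f′} g → (∀ d → 1 ≤ d → f d ≈ f′ d) → ∀ n → (f ⊛ g) n ≈ (f′ ⊛ g) n
  ⊛-congˡ g f≈f′ n = divSum-cong n (λ d e 1≤d _ _ → *-congʳ (f≈f′ d 1≤d))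

  ⊛-congʳ : ∀ f {g g′} → (∀ e → 1 ≤ e → g e ≈ g′ e) → ∀ n → (f ⊛ g) n ≈ (f ⊛ g′) n
  ⊛-congʳ f g≈g′ n = divSum-cong n (λ d e _ 1≤e _ → *-congˡ (g≈g′ e 1≤e))

  ⊛-comm : ∀ f g n → (f ⊛ g) n ≈ (g ⊛ f) n
  ⊛-comm f g zero      = refl
  ⊛-comm f g n@(suc _) = begin
    (f ⊛ g) n                                                   ≈⟨ divSum≈pairSum n n _ (s≤s z≤n) ℕ.≤-refl ⟩
    pairSum n n (λ d e → f d * g e)                             ≈⟨ Σ₁-swap n n _ ⟩
    Σ₁ n (λ e → Σ₁ n (λ d → when (d ℕ.* e ≟ n) (f d * g e)))    ≈⟨ Σ₁-cong n (λ e → Σ₁-cong n (λ d →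
                                                                     trans (when-≟-resp n _ (ℕ.*-comm d e)) (when-cong (e ℕ.* d ≟ n) (λ _ → *-comm _ _)))) ⟩
    pairSum n n (λ e d → g e * f d)                             ≈⟨ divSum≈pairSum n n _ (s≤s z≤n) ℕ.≤-refl ⟨
    (g ⊛ f) n ∎

  ⊛-⊛-expand : ∀ f g h n → 1 ≤ n →
    ((f ⊛ g) ⊛ h) n ≈ Σ₁ n (λ w → Σ₁ n (λ u → Σ₁ n (λ v → when (u ℕ.* v ℕ.* w ≟ n) (f u * g v * h w))))
  ⊛-⊛-expand f g h n 1≤n = begin
    ((f ⊛ g) ⊛ h) n
      ≈⟨ divSum-cong n (λ x w 1≤x 1≤w xw≡n → *-congʳ (divSum≈pairSum n x _ 1≤x (factor≤ xw≡n 1≤w))) ⟩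
    divSum n (λ x w → pairSum n x fg * h w)
      ≈⟨ divSum≈pairSum n n _ 1≤n ℕ.≤-refl ⟩
    pairSum n n (λ x w → pairSum n x fg * h w)
      ≈⟨ Σ₁-swap n n _ ⟩
    Σ₁ n (λ w → Σ₁ n (λ x → when (x ℕ.* w ≟ n) (pairSum n x fg * h w)))
      ≈⟨ Σ₁-cong-on n (λ w 1≤w _ → trans (Σ₁-cong n (λ x → when-cong (x ℕ.* w ≟ n) (λ _ → pairSum-*ʳ n x fg (h w))))
                                         (Σ₁-pairSum n w _ 1≤w)) ⟩
    Σ₁ n (λ w → Σ₁ n (λ u → Σ₁ n (λ v → when (u ℕ.* v ℕ.* w ≟ n) (f u * g v * h w)))) ∎
    where
    fg : ℕ → ℕ → Carrier
    fg u v = f u * g v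

  ⊛-assoc : ∀ f g h n → ((f ⊛ g) ⊛ h) n ≈ (f ⊛ (g ⊛ h)) n
  ⊛-assoc f g h zero      = refl
  ⊛-assoc f g h n@(suc _) = begin
    ((f ⊛ g) ⊛ h) n
      ≈⟨ ⊛-⊛-expand f g h n (s≤s z≤n) ⟩
    Σ₁ n (λ c → Σ₁ n (λ a → Σ₁ n (λ b → when (a ℕ.* b ℕ.* c ≟ n) (f a * g b * h c))))
      ≈⟨ Σ₁-cong n (λ c → Σ₁-cong n (λ a → Σ₁-cong n (λ b →
           trans (when-≟-resp n _ (ℕ-xy*z≡yz*x a b c)) (when-cong (b ℕ.* c ℕ.* a ≟ n) (λ _ → xy∙z≈yz∙x _ _ _))))) ⟩
    Σ₁ n (λ c → Σ₁ n (λ a → Σ₁ n (λ b → when (b ℕ.* c ℕ.* a ≟ n) (g b * h c * f a))))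
      ≈⟨ Σ₁-sink n n n _ ⟩
    Σ₁ n (λ a → Σ₁ n (λ b → Σ₁ n (λ c → when (b ℕ.* c ℕ.* a ≟ n) (g b * h c * f a))))
      ≈⟨ ⊛-⊛-expand g h f n (s≤s z≤n) ⟨
    ((g ⊛ h) ⊛ f) n
      ≈⟨ ⊛-comm (g ⊛ h) f n ⟩
    (f ⊛ (g ⊛ h)) n ∎

  γ̃≈⊛𝟙 : ∀ γ n → γ̃ γ n ≈ (γ ⊛ 𝟙) n
  γ̃≈⊛𝟙 γ n = divSum-cong n (λ d e _ _ _ → sym (*-identityʳ (γ d)))

  -- The coefficients c with Σ_{m ≥ 1} a_m q^{αm+β}/(1 - q^{αm+β}) = Σ_{e ≥ 1} c_e q^e/(1 - q^e).
  progression : (α β : ℕ) → ArithFun → ArithFun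
  progression α β a e = Σ₁ e (λ m → when (α ℕ.* m ℕ.+ β ≟ e) (a m))

  m≤αm+β : ∀ α β .{{_ : NonZero α}} m → m ≤ α ℕ.* m ℕ.+ β
  m≤αm+β α β m = ℕ.≤-trans (ℕ.m≤n*m m α) (ℕ.m≤m+n (α ℕ.* m) β)

  progression-extend : ∀ α β .{{_ : NonZero α}} a {e N} → e ≤ N →
    progression α β a e ≈ Σ₁ N (λ m → when (α ℕ.* m ℕ.+ β ≟ e) (a m))
  progression-extend α β a {e} e≤N =
    Σ₁-extend e≤N (λ m e<m _ → when-no (α ℕ.* m ℕ.+ β ≟ e) (λ αm+β≡e → ℕ.<⇒≱ e<m (P.subst (m ≤_) αm+β≡e (m≤αm+β α β m))))

  progression-≡ : ∀ α β .{{_ : NonZero α}} a {e} m → 1 ≤ m → α ℕ.* m ℕ.+ β ≡ e → progression α β a e ≈ a m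
  progression-≡ α β a {e} m 1≤m αm+β≡e =
    trans (Σ₁-single e m 1≤m (P.subst (m ≤_) αm+β≡e (m≤αm+β α β m)) off) (when-yes (α ℕ.* m ℕ.+ β ≟ e) αm+β≡e)
    where
    off : ∀ i → 1 ≤ i → i ≤ e → i ≢ m → when (α ℕ.* i ℕ.+ β ≟ e) (a i) ≈ 0#
    off i _ _ i≢m = when-no (α ℕ.* i ℕ.+ β ≟ e)
      (λ αi+β≡e → i≢m (ℕ.*-cancelˡ-≡ i m α (ℕ.+-cancelʳ-≡ β _ _ (P.trans αi+β≡e (P.sym αm+β≡e)))))

  progression-miss : ∀ α β a {e} → (∀ m → 1 ≤ m → α ℕ.* m ℕ.+ β ≢ e) → progression α β a e ≈ 0#
  progression-miss α β a {e} miss = Σ₁-zero e (λ m 1≤m _ → when-no (α ℕ.* m ℕ.+ β ≟ e) (miss m 1≤m))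

  lambertCoeff≈progression⊛𝟙 : ∀ α β .{{_ : NonZero α}} a d → lambertCoeff α β a d ≈ (progression α β a ⊛ 𝟙) d
  lambertCoeff≈progression⊛𝟙 α β a d = begin
    lambertCoeff α β a d
      ≈⟨ Σ₁-cong d summand ⟩
    Σ₁ d (λ m → when (α ℕ.* m ℕ.+ β ∣? d) (a m))
      ≈⟨ Σ₁-cong-on d (λ m 1≤m m≤d → Σ₁-δ-when d _ (α ℕ.* m ℕ.+ β ∣? d) (a m)
                          (ℕ.≤-trans 1≤m (m≤αm+β α β m)) (∣⇒≤ ⦃ >-nonZero (ℕ.≤-trans 1≤m m≤d) ⦄)) ⟨
    Σ₁ d (λ m → Σ₁ d (λ e → when (α ℕ.* m ℕ.+ β ≟ e) (when (α ℕ.* m ℕ.+ β ∣? d) (a m))))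
      ≈⟨ Σ₁-cong d (λ m → Σ₁-cong d (λ e → when-≟-swap (_∣? d) (α ℕ.* m ℕ.+ β) e (a m))) ⟨
    Σ₁ d (λ m → Σ₁ d (λ e → when (e ∣? d) (when (α ℕ.* m ℕ.+ β ≟ e) (a m))))
      ≈⟨ Σ₁-swap d d _ ⟩
    Σ₁ d (λ e → Σ₁ d (λ m → when (e ∣? d) (when (α ℕ.* m ℕ.+ β ≟ e) (a m))))
      ≈⟨ Σ₁-cong-on d (λ e _ e≤d → trans (when-cong (e ∣? d) (λ _ → trans (*-identityʳ _) (progression-extend α β a e≤d)))
                                         (when-Σ₁ (e ∣? d) d _)) ⟨
    Σ₁ d (λ e → when (e ∣? d) (progression α β a e * 1#))
      ≈⟨ divSum-divisors d _ ⟨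
    (progression α β a ⊛ 𝟙) d ∎
    where
    summand : ∀ m → argumentOf (Σ₁ d) {lambertCoeff α β a d} P.refl m ≈ when (α ℕ.* m ℕ.+ β ∣? d) (a m)
    summand m with α ℕ.* m ℕ.+ β ∣? d
    ... | yes _ = refl
    ... | no  _ = refl

  rhsSum≈progression⊛γ̃ : ∀ α β .{{_ : NonZero α}} a γ n → rhsSum α β a γ n ≈ (progression α β a ⊛ γ̃ γ) n
  rhsSum≈progression⊛γ̃ α β a γ n = divSum-cong n (λ d e 1≤d _ _ → summand d e 1≤d)
    where
    summand : ∀ d e → 1 ≤ d → argumentOf (divSum n) {rhsSum α β a γ n} P.refl d e ≈ progression α β a d * γ̃ γ e
    summand d e 1≤d with β <? d | α ∣? (d ∸ β)
    ... | yes β<d | yes α∣d∸β = *-congʳ (sym (progression-≡ α β a q 1≤q αq+β≡d))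
      where
      q = (d ∸ β) / α
      1≤q : 1 ≤ q
      1≤q = m≥n⇒m/n>0 (∣⇒≤ ⦃ >-nonZero (ℕ.m<n⇒0<n∸m β<d) ⦄ α∣d∸β)
      αq+β≡d : α ℕ.* q ℕ.+ β ≡ d
      αq+β≡d = P.trans (P.cong (ℕ._+ β) (m*[n/m]≡n α∣d∸β)) (ℕ.m∸n+n≡m (ℕ.<⇒≤ β<d))
    ... | yes _   | no α∤d∸β = sym (trans (*-congʳ (progression-miss α β a
      (λ m _ αm+β≡d → α∤d∸β (divides m (P.trans (P.cong (_∸ β) (P.sym αm+β≡d))
                                          (P.trans (ℕ.m+n∸n≡m (α ℕ.* m) β) (ℕ.*-comm α m)))))))
      (zeroˡ _))
    ... | no β≮d  | _ = sym (trans (*-congʳ (progression-miss α β a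
      (λ m 1≤m αm+β≡d → β≮d (P.subst (β <_) αm+β≡d (ℕ.m<n+m β (ℕ.≤-trans 1≤m (ℕ.m≤n*m m α)))))))
      (zeroˡ _))

  Σ₁-sInv : ∀ (F T : Series) (γ : ArithFun) → T 0 ≈ 0# → ∀ n →
            Σ₁ n (λ j → sInv F γ n j * T j) ≈ ((F ⋆ T) ⊛ γ) n
  Σ₁-sInv F T γ T0≈0 n = begin
    Σ₁ n (λ j → sInv F γ n j * T j)                               ≈⟨ Σ₁-cong n (λ j → divSum-*ʳ n _ (T j)) ⟩
    Σ₁ n (λ j → divSum n (λ d e → coeffShift F d j * γ e * T j))  ≈⟨ Σ₁-divSum n n _ ⟩
    divSum n (λ d e → Σ₁ n (λ j → coeffShift F d j * γ e * T j))  ≈⟨ divSum-cong n convolve ⟩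
    ((F ⋆ T) ⊛ γ) n ∎
    where
    convolve : ∀ d e → 1 ≤ d → 1 ≤ e → d ℕ.* e ≡ n → Σ₁ n (λ j → coeffShift F d j * γ e * T j) ≈ (F ⋆ T) d * γ e
    convolve d e _ 1≤e de≡n = begin
      Σ₁ n (λ j → coeffShift F d j * γ e * T j) ≈⟨ Σ₁-cong n (λ j → xy∙z≈xz∙y _ _ _) ⟩
      Σ₁ n (λ j → coeffShift F d j * T j * γ e) ≈⟨ Σ₁-*ʳ n (γ e) _ ⟨
      Σ₁ n (λ j → coeffShift F d j * T j) * γ e ≈⟨ *-congʳ (Σ₁-coeffShift F T T0≈0 (factor≤ de≡n 1≤e)) ⟩
      (F ⋆ T) d * γ e ∎

theorem3p1 : ∀ {c ℓ} (R : CommutativeRing c ℓ) → let open WithRing R in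
    (α β : ℕ) → .{{_ : NonZero α}} → 1 ≤ α → β < α →
    (C Cinv : Series) → IsUnit (C 0) → (∀ m → (C ⋆ Cinv) m ≈ one m) →
    (γ : ArithFun) → IsUnit (γ 1) →
    (s : Matrix) → LowerTriangular s → IsInverseLT (sInv Cinv γ) s →
    (a ā : ArithFun) →
    (∀ m → lambertCoeff α β a m ≈ (Cinv ⋆ sTransform s ā) m) →
    ∀ n → 1 ≤ n → ā n ≈ rhsSum α β a γ n
theorem3p1 R α β _ _ _ Cinv _ _ γ _ s s-lower s-inverse a ā lambert n 1≤n = begin
  ā n                                             ≈⟨ sTransform-leftInverse (sInv Cinv γ) s ā s-lower (proj₁ s-inverse) n 1≤n ⟨
  Σ₁ n (λ j → sInv Cinv γ n j * sTransform s ā j) ≈⟨ Σ₁-sInv Cinv (sTransform s ā) γ refl n ⟩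
  ((Cinv ⋆ sTransform s ā) ⊛ γ) n                 ≈⟨ ⊛-congˡ γ (λ d _ → sym (lambert d)) n ⟩
  (lambertCoeff α β a ⊛ γ) n                      ≈⟨ ⊛-congˡ γ (λ d _ → lambertCoeff≈progression⊛𝟙 α β a d) n ⟩
  ((c ⊛ 𝟙) ⊛ γ) n                                 ≈⟨ ⊛-assoc c 𝟙 γ n ⟩
  (c ⊛ (𝟙 ⊛ γ)) n                                 ≈⟨ ⊛-congʳ c (λ e _ → trans (⊛-comm 𝟙 γ e) (sym (γ̃≈⊛𝟙 γ e))) n ⟩
  (c ⊛ γ̃ γ) n                                     ≈⟨ rhsSum≈progression⊛γ̃ α β a γ n ⟨
  rhsSum α β a γ n ∎
  where
  open WithRing R
  open CommutativeRing R using (_*_; refl; sym; trans; setoid)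
  open import Relation.Binary.Reasoning.Setoid setoid
  open Properties R
  c : ArithFun
  c = progression α β a
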